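{- Let $n,k$ be positive integers and let $\mathcal{V}^k_n$ be the class of all simple bipartite graphs on $n$ vertices with vertex connectivity exactly $k$. Let $G\in\mathcal{V}^k_n$, with bipartition $(X,Y)$, attain the maximum value of $M_1$ over $\mathcal{V}^k_n$ and also the maximum value of $M_2$ over $\mathcal{V}^k_n$. If $S$ is a vertex cut set of $G$ with $|S|=k$, $S\subseteq X$ and $|X|>k$, then $G-S$ has exactly two connected components, one of which is a single (isolated) vertex.
   Context: All graphs are finite, simple and undirected. $M_1(G)=\sum_{u\in V(G)} d(u)^2$ and $M_2(G)=\sum_{uv\in E(G)} d(u)d(v)$, where $d(u)$ is the degree of $u$. The vertex connectivity $\kappa(G)$ is the largest integer $k$ such that $|V(G)|>k$ and $G-X$ is connected for every $X\subseteq V(G)$ with $|X|<k$. A vertex cut set of a connected graph $G$ is a set $W\subseteq V(G)$ such that $G-W$ is disconnected. -}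

module Defs where

open import Data.Nat using (ℕ; zero; suc; _+_; _*_; _^_; _≤_; _<_)
open import Data.Nat.Properties using (_<?_)
open import Data.Fin using (Fin; toℕ)
open import Data.Fin.Subset using (Subset; _∈_; _∉_; _⊆_; ∣_∣)
open import Data.Bool using (Bool; true; false; if_then_else_; _∧_)
open import Data.List using (List; map; allFin)
open import Data.Nat.ListAction using (sum)
open import Data.Product using (Σ; ∃; _×_; _,_)
open import Data.Sum using (_⊎_)
open import Relation.Nullary using (¬_)
open import Relation.Nullary.Decidable using (⌊_⌋)
open import Relation.Binary.PropositionalEquality using (_≡_; _≢_)

record Graph (n : ℕ) : Set where
  field
    adj    : Fin n → Fin n → Bool
    sym    : ∀ i j → adj i j ≡ adj j i
    irrefl : ∀ i → adj i i ≡ false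
open Graph public

Σv : ∀ {n} → (Fin n → ℕ) → ℕ
Σv {n} f = sum (map f (allFin n))

b2n : Bool → ℕ
b2n true  = 1
b2n false = 0

degree : ∀ {n} → Graph n → Fin n → ℕ
degree G u = Σv (λ v → b2n (adj G u v))

M1 : ∀ {n} → Graph n → ℕ
M1 G = Σv (λ u → degree G u ^ 2)

-- M2(G) = Σ_{uv ∈ E} d(u) d(v); each edge counted once via toℕ u < toℕ v
M2 : ∀ {n} → Graph n → ℕ
M2 G = Σv (λ u → Σv (λ v →
  if ⌊ toℕ u <? toℕ v ⌋ ∧ adj G u v then degree G u * degree G v else 0))

-- Reachability in G - X (walks using only vertices outside X)
data Reach {n} (G : Graph n) (X : Subset n) : Fin n → Fin n → Set where
  here : ∀ {u} → u ∉ X → Reach G X u u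
  step : ∀ {u v w} → u ∉ X → adj G u v ≡ true → Reach G X v w → Reach G X u w

Connected- : ∀ {n} → Graph n → Subset n → Set
Connected- {n} G X = ∀ (u v : Fin n) → u ∉ X → v ∉ X → Reach G X u v

ConnProp : ∀ {n} → Graph n → ℕ → Set
ConnProp {n} G k = k < n × (∀ (X : Subset n) → ∣ X ∣ < k → Connected- G X)

VertexConnectivity : ∀ {n} → Graph n → ℕ → Set
VertexConnectivity G k = ConnProp G k × (∀ m → ConnProp G m → m ≤ k)

-- X is one side of a bipartition (X, complement of X) of G
IsBipartition : ∀ {n} → Graph n → Subset n → Set
IsBipartition G X = ∀ i j → adj G i j ≡ true → (i ∈ X × j ∉ X) ⊎ (i ∉ X × j ∈ X)

IsBipartite : ∀ {n} → Graph n → Set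
IsBipartite {n} G = Σ (Subset n) (IsBipartition G)

InClass : (n k : ℕ) → Graph n → Set
InClass n k G = IsBipartite G × VertexConnectivity G k

IsVertexCut : ∀ {n} → Graph n → Subset n → Set
IsVertexCut G W = ¬ Connected- G W

-- G - S has exactly two connected components, one of which is a single
-- vertex w: w ∉ S is isolated in G - S, there is another vertex outside S,
-- and all vertices of G - S other than w lie in one component.
TwoComponentsOneTrivial : ∀ {n} → Graph n → Subset n → Set
TwoComponentsOneTrivial {n} G S =
  Σ (Fin n) λ w → w ∉ S
    × (∀ u → u ∉ S → adj G w u ≡ false)
    × (Σ (Fin n) λ u → u ∉ S × u ≢ w)
    × (∀ u v → u ∉ S → v ∉ S → u ≢ w → v ≢ w → Reach G S u v)

module Submission where

-- The argument replaces G by explicit competitors in the class and compares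
-- M1.  Any X-bipartite, k-connected graph in which S is still a cut lies in the
-- class, so it cannot have larger M1.  Adding a single edge raises M1, hence
-- every X-edge whose addition keeps S a cut is already present ("saturation").
-- Saturation forces X ∖ S to be pairwise linked: otherwise two vertices
-- x₁, x₂ of X ∖ S lie in different components of G - S, and the graph joining
-- X completely to its complement except X ∖ S to one neighbour y₀ of x₁ beats
-- G by a degree count at y₀ and a neighbour y₂ of x₂.  Once X ∖ S is linked,
-- some vertex w outside X has no neighbour in X ∖ S (else G - S would be
-- connected), and saturation joins X ∖ S to every other vertex outside X.

open import Data.Bool using (Bool; true; false; _∨_)
open import Data.Bool.Properties using (∨-comm) renaming (_≟_ to _≟ᵇ_)
open import Data.Empty using (⊥; ⊥-elim)
open import Data.Fin using (Fin; zero; suc)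
open import Data.Fin.Properties using (_≟_; any?)
open import Data.Fin.Subset
  using (Subset; ⁅_⁆; _∈_; _∉_; _⊆_; _⊂_; ∣_∣; _∪_; _∩_; ∁; Empty) renaming (⊥ to ∅)
open import Data.Fin.Subset.Properties
  using (_∈?_; p⊆q⇒∣p∣≤∣q∣; p⊂q⇒∣p∣<∣q∣; Empty-unique; ∣⊥∣≡0; ∉⊥; ⊥⊆; ∣⁅x⁆∣≡1; x∈⁅x⁆;
         x∈p∩q⁺; x∈p∩q⁻; x∈p∪q⁺; x∈p∪q⁻; x∈∁p⇒x∉p; x∉p⇒x∈∁p)
open import Data.List.Properties using (map-tabulate)
open import Data.Nat using (ℕ; zero; suc; _+_; _*_; _^_; _∸_; _≤_; _<_; z≤n; >-nonZero)
open import Data.Nat.ListAction using (sum)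
open import Data.Nat.Properties
  using (+-comm; +-assoc; +-suc; +-identityʳ; *-identityʳ; ≤-trans; ≤-reflexive; <-≤-trans;
         <⇒≱; ≮⇒≥; m≤m+n; m≤n+m; m∸n+n≡m; +-mono-≤; +-monoˡ-≤; +-monoʳ-<; +-mono-<-≤;
         +-cancelʳ-≤; +-cancelʳ-<; *-monoˡ-<; *-monoʳ-<; ^-monoˡ-≤; ^-monoˡ-<; module ≤-Reasoning)
open import Data.Nat.Tactic.RingSolver using (solve-∀)
open import Data.Product using (∃; _×_; _,_; proj₁; proj₂)
open import Data.Sum using (_⊎_; inj₁; inj₂)
open import Data.Vec using ([]; _∷_; tabulate)
open import Data.Vec.Properties using ([]=⇒lookup; lookup⇒[]=; lookup∘tabulate)
open import Data.Vec.Functional using (updateAt)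
open import Data.Vec.Functional.Properties using (updateAt-updates; updateAt-minimal)
open import Function using (_∘_; const)
open import Relation.Binary.PropositionalEquality
  using (_≡_; _≢_; refl; sym; trans; cong; subst; subst₂; module ≡-Reasoning)
open import Relation.Nullary using (¬_; Dec; does; yes; no; contradiction)
open import Relation.Nullary.Decidable
  using (_×-dec_; _⊎-dec_; ¬?; dec-true; dec-false; decidable-stable)

open import Defs hiding (sym)

Σv-suc : ∀ {n} (f : Fin (suc n) → ℕ) → Σv f ≡ f zero + Σv (f ∘ suc)
Σv-suc f = cong (λ xs → f zero + sum xs)
  (trans (map-tabulate suc f) (sym (map-tabulate (λ i → i) (f ∘ suc))))

Σv-mono : ∀ {n} {f g : Fin n → ℕ} → (∀ v → f v ≤ g v) → Σv f ≤ Σv g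
Σv-mono {zero}  f≤g = z≤n
Σv-mono {suc n} {f} {g} f≤g = begin
  Σv f                  ≡⟨ Σv-suc f ⟩
  f zero + Σv (f ∘ suc) ≤⟨ +-mono-≤ (f≤g zero) (Σv-mono (f≤g ∘ suc)) ⟩
  g zero + Σv (g ∘ suc) ≡⟨ Σv-suc g ⟨
  Σv g                  ∎
  where open ≤-Reasoning

Σv-updateAt : ∀ {n} (f : Fin n → ℕ) (i : Fin n) (a : ℕ) →
              Σv (updateAt f i (const a)) + f i ≡ Σv f + a
Σv-updateAt {suc n} f zero a = begin
  Σv (updateAt f zero (const a)) + f zero
    ≡⟨ cong (_+ f zero) (Σv-suc (updateAt f zero (const a))) ⟩
  a + Σv (f ∘ suc) + f zero
    ≡⟨ swap-ends a (Σv (f ∘ suc)) (f zero) ⟩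
  f zero + Σv (f ∘ suc) + a
    ≡⟨ cong (_+ a) (Σv-suc f) ⟨
  Σv f + a ∎
  where
  open ≡-Reasoning
  swap-ends : ∀ a s b → a + s + b ≡ b + s + a
  swap-ends = solve-∀
Σv-updateAt {suc n} f (suc i) a = begin
  Σv (updateAt f (suc i) (const a)) + f (suc i)
    ≡⟨ cong (_+ f (suc i)) (Σv-suc (updateAt f (suc i) (const a))) ⟩
  f zero + Σv (updateAt (f ∘ suc) i (const a)) + f (suc i)
    ≡⟨ +-assoc (f zero) _ _ ⟩
  f zero + (Σv (updateAt (f ∘ suc) i (const a)) + f (suc i))
    ≡⟨ cong (f zero +_) (Σv-updateAt (f ∘ suc) i a) ⟩
  f zero + (Σv (f ∘ suc) + a)
    ≡⟨ +-assoc (f zero) _ _ ⟨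
  f zero + Σv (f ∘ suc) + a
    ≡⟨ cong (_+ a) (Σv-suc f) ⟨
  Σv f + a ∎
  where open ≡-Reasoning

Σv-exchange : ∀ {n} {f g : Fin n → ℕ} (i : Fin n) →
              (∀ v → v ≢ i → f v ≤ g v) → Σv f + g i ≤ Σv g + f i
Σv-exchange {f = f} {g} i f≤g = begin
  Σv f + g i                            ≡⟨ Σv-updateAt f i (g i) ⟨
  Σv (updateAt f i (const (g i))) + f i ≤⟨ +-monoˡ-≤ (f i) (Σv-mono below) ⟩
  Σv g + f i                            ∎
  where
  open ≤-Reasoning
  below : ∀ v → updateAt f i (const (g i)) v ≤ g v
  below v with v ≟ i
  ... | yes refl = ≤-reflexive (updateAt-updates i f)
  ... | no v≢i   = subst (_≤ g v) (sym (updateAt-minimal v i f v≢i)) (f≤g v v≢i)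

Σv-<-two-points : ∀ {n} {f g : Fin n → ℕ} (i j : Fin n) → i ≢ j →
                  (∀ v → v ≢ i → v ≢ j → f v ≤ g v) →
                  f i + f j < g i + g j → Σv f < Σv g
Σv-<-two-points {f = f} {g} i j i≢j f≤g increase =
  +-cancelʳ-< (g i + g j) (Σv f) (Σv g) (begin-strict
    Σv f + (g i + g j)     ≡⟨ reassoc (Σv f) (g i) (g j) ⟩
    (Σv f + g j) + g i     ≡⟨ cong (_+ g i) (Σv-updateAt f j (g j)) ⟨
    Σv f′ + f j + g i      ≡⟨ reassoc′ (Σv f′) (f j) (g i) ⟩
    Σv f′ + g i + f j      ≤⟨ +-monoˡ-≤ (f j) (Σv-exchange i f′≤g) ⟩
    Σv g + f′ i + f j      ≡⟨ cong (λ x → Σv g + x + f j) (updateAt-minimal i j f i≢j) ⟩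
    Σv g + f i + f j       ≡⟨ +-assoc (Σv g) (f i) (f j) ⟩
    Σv g + (f i + f j)     <⟨ +-monoʳ-< (Σv g) increase ⟩
    Σv g + (g i + g j)     ∎)
  where
  open ≤-Reasoning
  f′ : Fin _ → ℕ
  f′ = updateAt f j (const (g j))
  f′≤g : ∀ v → v ≢ i → f′ v ≤ g v
  f′≤g v v≢i with v ≟ j
  ... | yes refl = ≤-reflexive (updateAt-updates j f)
  ... | no v≢j   = subst (_≤ g v) (sym (updateAt-minimal v j f v≢j)) (f≤g v v≢i v≢j)
  reassoc : ∀ s a b → s + (a + b) ≡ s + b + a
  reassoc = solve-∀
  reassoc′ : ∀ s a b → s + a + b ≡ s + b + a
  reassoc′ = solve-∀

-- Squares as products, the form the ring solver understands.
square : ∀ x → x ^ 2 ≡ x * x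
square x = cong (x *_) (*-identityʳ x)

squares-exchange : ∀ k a c → 0 < a → k < c → (k + a) ^ 2 + c ^ 2 < k ^ 2 + (c + a) ^ 2
squares-exchange k a c 0<a k<c
  rewrite square (k + a) | square c | square k | square (c + a) = begin-strict
  (k + a) * (k + a) + c * c               ≡⟨ expand-left k a c ⟩
  k * k + c * c + a * a + 2 * (k * a)     <⟨ +-monoʳ-< (k * k + c * c + a * a) (*-monoʳ-< 2 ka<ca) ⟩
  k * k + c * c + a * a + 2 * (c * a)     ≡⟨ expand-right k a c ⟨
  k * k + (c + a) * (c + a)               ∎
  where
  open ≤-Reasoning
  ka<ca : k * a < c * a
  ka<ca = *-monoˡ-< a {{>-nonZero 0<a}} k<c
  expand-left : ∀ x y z → (x + y) * (x + y) + z * z ≡ x * x + z * z + y * y + 2 * (x * y)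
  expand-left = solve-∀
  expand-right : ∀ x y z → x * x + (z + y) * (z + y) ≡ x * x + z * z + y * y + 2 * (z * y)
  expand-right = solve-∀

squares-bound : ∀ {D₀ D₂ H₀ H₂ k a Z} → D₀ ≤ k + a → D₂ + a ≤ Z → k + a < Z → 0 < a →
                k ≤ H₀ → Z ≤ H₂ → D₀ ^ 2 + D₂ ^ 2 < H₀ ^ 2 + H₂ ^ 2
squares-bound {D₀} {D₂} {H₀} {H₂} {k} {a} {Z} D₀≤k+a D₂+a≤Z k+a<Z 0<a k≤H₀ Z≤H₂ = begin-strict
  D₀ ^ 2 + D₂ ^ 2           ≤⟨ +-mono-≤ (^-monoˡ-≤ 2 D₀≤k+a) (^-monoˡ-≤ 2 D₂≤c) ⟩
  (k + a) ^ 2 + c ^ 2       <⟨ squares-exchange k a c 0<a k<c ⟩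
  k ^ 2 + (c + a) ^ 2       ≡⟨ cong (λ z → k ^ 2 + z ^ 2) c+a≡Z ⟩
  k ^ 2 + Z ^ 2             ≤⟨ +-mono-≤ (^-monoˡ-≤ 2 k≤H₀) (^-monoˡ-≤ 2 Z≤H₂) ⟩
  H₀ ^ 2 + H₂ ^ 2           ∎
  where
  open ≤-Reasoning
  c : ℕ
  c = Z ∸ a
  c+a≡Z : c + a ≡ Z
  c+a≡Z = m∸n+n≡m (≤-trans (m≤n+m a D₂) D₂+a≤Z)
  k<c : k < c
  k<c = +-cancelʳ-< a k c (subst (k + a <_) (sym c+a≡Z) k+a<Z)
  D₂≤c : D₂ ≤ c
  D₂≤c = +-cancelʳ-≤ a D₂ c (subst (D₂ + a ≤_) (sym c+a≡Z) D₂+a≤Z)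

Σv-count : ∀ {n} (p : Fin n → Bool) → Σv (b2n ∘ p) ≡ ∣ tabulate p ∣
Σv-count {zero}  p = refl
Σv-count {suc n} p = trans (Σv-suc (b2n ∘ p)) (head+tail (p zero))
  where
  head+tail : ∀ b → b2n b + Σv (b2n ∘ p ∘ suc) ≡ ∣ b ∷ tabulate (p ∘ suc) ∣
  head+tail true  = cong suc (Σv-count (p ∘ suc))
  head+tail false = Σv-count (p ∘ suc)

∣p∪q∣+∣p∩q∣≡∣p∣+∣q∣ : ∀ {n} (p q : Subset n) → ∣ p ∪ q ∣ + ∣ p ∩ q ∣ ≡ ∣ p ∣ + ∣ q ∣
∣p∪q∣+∣p∩q∣≡∣p∣+∣q∣ []          []          = refl
∣p∪q∣+∣p∩q∣≡∣p∣+∣q∣ (true  ∷ p) (true  ∷ q) = cong suc (begin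
  ∣ p ∪ q ∣ + suc ∣ p ∩ q ∣ ≡⟨ +-suc ∣ p ∪ q ∣ ∣ p ∩ q ∣ ⟩
  suc (∣ p ∪ q ∣ + ∣ p ∩ q ∣) ≡⟨ cong suc (∣p∪q∣+∣p∩q∣≡∣p∣+∣q∣ p q) ⟩
  suc (∣ p ∣ + ∣ q ∣)       ≡⟨ +-suc ∣ p ∣ ∣ q ∣ ⟨
  ∣ p ∣ + suc ∣ q ∣         ∎)
  where open ≡-Reasoning
∣p∪q∣+∣p∩q∣≡∣p∣+∣q∣ (true  ∷ p) (false ∷ q) = cong suc (∣p∪q∣+∣p∩q∣≡∣p∣+∣q∣ p q)
∣p∪q∣+∣p∩q∣≡∣p∣+∣q∣ (false ∷ p) (true  ∷ q) =
  trans (cong suc (∣p∪q∣+∣p∩q∣≡∣p∣+∣q∣ p q)) (sym (+-suc ∣ p ∣ ∣ q ∣))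
∣p∪q∣+∣p∩q∣≡∣p∣+∣q∣ (false ∷ p) (false ∷ q) = ∣p∪q∣+∣p∩q∣≡∣p∣+∣q∣ p q

∣p∪q∣≤∣p∣+∣q∣ : ∀ {n} (p q : Subset n) → ∣ p ∪ q ∣ ≤ ∣ p ∣ + ∣ q ∣
∣p∪q∣≤∣p∣+∣q∣ p q = subst (∣ p ∪ q ∣ ≤_) (∣p∪q∣+∣p∩q∣≡∣p∣+∣q∣ p q) (m≤m+n _ _)

disjoint-∣p∪q∣ : ∀ {n} (p q : Subset n) → Empty (p ∩ q) → ∣ p ∪ q ∣ ≡ ∣ p ∣ + ∣ q ∣
disjoint-∣p∪q∣ {n} p q disjoint = begin
  ∣ p ∪ q ∣                 ≡⟨ +-identityʳ _ ⟨
  ∣ p ∪ q ∣ + 0             ≡⟨ cong (∣ p ∪ q ∣ +_) ∣p∩q∣≡0 ⟨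
  ∣ p ∪ q ∣ + ∣ p ∩ q ∣     ≡⟨ ∣p∪q∣+∣p∩q∣≡∣p∣+∣q∣ p q ⟩
  ∣ p ∣ + ∣ q ∣             ∎
  where
  open ≡-Reasoning
  ∣p∩q∣≡0 : ∣ p ∩ q ∣ ≡ 0
  ∣p∩q∣≡0 = trans (cong ∣_∣ (Empty-unique disjoint)) (∣⊥∣≡0 n)

⊂-one-more⇒≤ : ∀ {n} {p q r : Subset n} (b : Fin n) → p ⊂ r → r ⊆ q ∪ ⁅ b ⁆ → ∣ p ∣ ≤ ∣ q ∣
⊂-one-more⇒≤ {p = p} {q} {r} b p⊂r r⊆q+b = +-cancelʳ-≤ 1 ∣ p ∣ ∣ q ∣ (begin
  ∣ p ∣ + 1             ≡⟨ +-comm ∣ p ∣ 1 ⟩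
  suc ∣ p ∣             ≤⟨ p⊂q⇒∣p∣<∣q∣ p⊂r ⟩
  ∣ r ∣                 ≤⟨ p⊆q⇒∣p∣≤∣q∣ r⊆q+b ⟩
  ∣ q ∪ ⁅ b ⁆ ∣         ≤⟨ ∣p∪q∣≤∣p∣+∣q∣ q ⁅ b ⁆ ⟩
  ∣ q ∣ + ∣ ⁅ b ⁆ ∣     ≡⟨ cong (∣ q ∣ +_) (∣⁅x⁆∣≡1 b) ⟩
  ∣ q ∣ + 1             ∎)
  where open ≤-Reasoning

larger⇒element-outside : ∀ {n} (p q : Subset n) → ∣ q ∣ < ∣ p ∣ → ∃ λ x → x ∈ p × x ∉ q
larger⇒element-outside p q ∣q∣<∣p∣ with any? (λ x → x ∈? p ×-dec ¬? (x ∈? q))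
... | yes witness = witness
... | no none = contradiction (p⊆q⇒∣p∣≤∣q∣ p⊆q) (<⇒≱ ∣q∣<∣p∣)
  where
  p⊆q : p ⊆ q
  p⊆q {x} x∈p with x ∈? q
  ... | yes x∈q = x∈q
  ... | no x∉q  = contradiction (x , x∈p , x∉q) none

nbhd : ∀ {n} → Graph n → Fin n → Subset n
nbhd G u = tabulate (adj G u)

∈nbhd⁺ : ∀ {n} (G : Graph n) {u v} → adj G u v ≡ true → v ∈ nbhd G u
∈nbhd⁺ G {u} {v} uv = lookup⇒[]= v (nbhd G u) (trans (lookup∘tabulate (adj G u) v) uv)

∈nbhd⁻ : ∀ {n} (G : Graph n) {u v} → v ∈ nbhd G u → adj G u v ≡ true
∈nbhd⁻ G {u} {v} v∈N = trans (sym (lookup∘tabulate (adj G u) v)) ([]=⇒lookup v∈N)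

degree≡∣nbhd∣ : ∀ {n} (G : Graph n) u → degree G u ≡ ∣ nbhd G u ∣
degree≡∣nbhd∣ G u = Σv-count (adj G u)

M1-increase : ∀ {n} (G H : Graph n) (i j : Fin n) → i ≢ j →
              (∀ v → v ≢ i → v ≢ j → degree G v ≤ degree H v) →
              degree G i ^ 2 + degree G j ^ 2 < degree H i ^ 2 + degree H j ^ 2 →
              M1 G < M1 H
M1-increase G H i j i≢j degrees≤ =
  Σv-<-two-points i j i≢j (λ v v≢i v≢j → ^-monoˡ-≤ 2 (degrees≤ v v≢i v≢j))

_⊑_ : ∀ {n} → Graph n → Graph n → Set
G ⊑ H = ∀ u v → adj G u v ≡ true → adj H u v ≡ true

M1-supergraph : ∀ {n} (G H : Graph n) → G ⊑ H → ∀ x y →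
                adj G x y ≡ false → adj H x y ≡ true → M1 G < M1 H
M1-supergraph G H G⊑H x y xy∉G xy∈H =
  M1-increase G H x y x≢y (λ v _ _ → degree-mono v)
    (+-mono-<-≤ (^-monoˡ-< 2 degree-x) (^-monoˡ-≤ 2 (degree-mono y)))
  where
  x≢y : x ≢ y
  x≢y refl = contradiction (trans (sym xy∈H) (irrefl H x)) λ ()
  nbhd-⊆ : ∀ v → nbhd G v ⊆ nbhd H v
  nbhd-⊆ v w∈N = ∈nbhd⁺ H (G⊑H v _ (∈nbhd⁻ G w∈N))
  degree-mono : ∀ v → degree G v ≤ degree H v
  degree-mono v = subst₂ _≤_ (sym (degree≡∣nbhd∣ G v)) (sym (degree≡∣nbhd∣ H v))
                         (p⊆q⇒∣p∣≤∣q∣ (nbhd-⊆ v))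
  y∉nbhdG : y ∉ nbhd G x
  y∉nbhdG y∈N = contradiction (trans (sym xy∉G) (∈nbhd⁻ G y∈N)) λ ()
  degree-x : degree G x < degree H x
  degree-x = subst₂ _<_ (sym (degree≡∣nbhd∣ G x)) (sym (degree≡∣nbhd∣ H x))
                    (p⊂q⇒∣p∣<∣q∣ (nbhd-⊆ x , y , ∈nbhd⁺ H xy∈H , y∉nbhdG))

module _ {n} {G : Graph n} {T : Subset n} where

  reach-start : ∀ {u v} → Reach G T u v → u ∉ T
  reach-start (here u∉T)     = u∉T
  reach-start (step u∉T _ _) = u∉T

  reach-edge : ∀ {u v} → u ∉ T → v ∉ T → adj G u v ≡ true → Reach G T u v
  reach-edge u∉T v∉T uv = step u∉T uv (here v∉T)

  reach-trans : ∀ {u v w} → Reach G T u v → Reach G T v w → Reach G T u w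
  reach-trans (here _)        r = r
  reach-trans (step u∉T uv p) r = step u∉T uv (reach-trans p r)

  reach-sym : ∀ {u v} → Reach G T u v → Reach G T v u
  reach-sym (here u∉T) = here u∉T
  reach-sym {u} (step {v = v} u∉T uv p) =
    reach-trans (reach-sym p) (reach-edge (reach-start p) u∉T (trans (Graph.sym G v u) uv))

  trapped : ∀ {u w} → (∀ v → adj G u v ≡ true → v ∈ T) → Reach G T u w → u ≡ w
  trapped nbrs⊆T (here _)         = refl
  trapped nbrs⊆T (step _ uv rest) = contradiction (nbrs⊆T _ uv) (reach-start rest)

reach-⊑ : ∀ {n} {G H : Graph n} {T : Subset n} → G ⊑ H → ∀ {u v} → Reach G T u v → Reach H T u v
reach-⊑ G⊑H (here u∉T)      = here u∉T
reach-⊑ G⊑H (step u∉T uv p) = step u∉T (G⊑H _ _ uv) (reach-⊑ G⊑H p)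

ConnProp-⊑ : ∀ {n k} {G H : Graph n} → G ⊑ H → ConnProp G k → ConnProp H k
ConnProp-⊑ G⊑H (k<n , connected) =
  k<n , λ T ∣T∣<k u v u∉T v∉T → reach-⊑ G⊑H (connected T ∣T∣<k u v u∉T v∉T)

cut⇒connectivity : ∀ {n k} (G : Graph n) (W : Subset n) →
                   ConnProp G k → IsVertexCut G W → ∣ W ∣ ≡ k → VertexConnectivity G k
cut⇒connectivity G W conn cut ∣W∣≡k = conn , λ m connₘ →
  ≮⇒≥ (λ k<m → cut (proj₂ connₘ W (subst (_< m) (sym ∣W∣≡k) k<m)))

has-neighbour : ∀ {n k} (G : Graph n) → ConnProp G k → 0 < k →
                ∀ {u v} → u ≢ v → ∃ λ w → adj G u w ≡ true
has-neighbour {n} G (_ , connected) 0<k {u} {v} u≢v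
  with connected ∅ (subst (_< _) (sym (∣⊥∣≡0 n)) 0<k) u v ∉⊥ ∉⊥
... | here _             = contradiction refl u≢v
... | step {v = w} _ uw _ = w , uw

-- Minimum degree is at least the connectivity: the neighbourhood of u
-- separates u from any non-adjacent vertex v.
min-degree : ∀ {n k} (G : Graph n) → ConnProp G k →
             ∀ {u v} → u ≢ v → adj G u v ≡ false → k ≤ degree G u
min-degree G (_ , connected) {u} {v} u≢v uv∉G = ≮⇒≥ λ degree<k →
  u≢v (trapped (λ w uw → ∈nbhd⁺ G uw)
    (connected (nbhd G u) (subst (_< _) (degree≡∣nbhd∣ G u) degree<k) u v u∉N v∉N))
  where
  u∉N : u ∉ nbhd G u
  u∉N u∈N = contradiction (trans (sym (irrefl G u)) (∈nbhd⁻ G u∈N)) λ ()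
  v∉N : v ∉ nbhd G u
  v∉N v∈N = contradiction (trans (sym uv∉G) (∈nbhd⁻ G v∈N)) λ ()

module _ {n} (X : Subset n) {R : Fin n → Fin n → Set} (R? : ∀ u v → Dec (R u v)) where

  Crossing : Fin n → Fin n → Set
  Crossing u v = u ∈ X × v ∉ X × R u v

  crossing? : ∀ u v → Dec (Crossing u v)
  crossing? u v = u ∈? X ×-dec ¬? (v ∈? X) ×-dec R? u v

  crossGraph : Graph n
  crossGraph = record
    { adj    = λ u v → does (crossing? u v) ∨ does (crossing? v u)
    ; sym    = λ u v → ∨-comm (does (crossing? u v)) (does (crossing? v u))
    ; irrefl = λ u → cong (λ b → b ∨ b) (dec-false (crossing? u u) λ (u∈X , u∉X , _) → u∉X u∈X)
    }

  crossGraph-edge⁺ : ∀ {u v} → Crossing u v → adj crossGraph u v ≡ true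
  crossGraph-edge⁺ {u} {v} c rewrite dec-true (crossing? u v) c = refl

  crossGraph-edge⁻ : ∀ {u v} → adj crossGraph u v ≡ true → Crossing u v ⊎ Crossing v u
  crossGraph-edge⁻ {u} {v} = either (crossing? u v) (crossing? v u)
    where
    either : ∀ {A B : Set} (a? : Dec A) (b? : Dec B) → does a? ∨ does b? ≡ true → A ⊎ B
    either (yes a) _       _  = inj₁ a
    either (no _)  (yes b) _  = inj₂ b
    either (no _)  (no _)  ()

  crossGraph-bipartite : IsBipartition crossGraph X
  crossGraph-bipartite u v uv with crossGraph-edge⁻ uv
  ... | inj₁ (u∈X , v∉X , _) = inj₁ (u∈X , v∉X)
  ... | inj₂ (v∈X , u∉X , _) = inj₂ (u∉X , v∈X)

module Extremal {n k : ℕ} (G : Graph n) (κG : VertexConnectivity G k) (0<k : 0 < k)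
  (M1-max : ∀ (H : Graph n) → InClass n k H → M1 H ≤ M1 G)
  (X : Subset n) (bip : IsBipartition G X)
  (S : Subset n) (S-cut : IsVertexCut G S) (∣S∣≡k : ∣ S ∣ ≡ k) (S⊆X : S ⊆ X)
  where

  connG : ConnProp G k
  connG = proj₁ κG

  adj-sym : ∀ {u v} → adj G u v ≡ true → adj G v u ≡ true
  adj-sym {u} {v} uv = trans (Graph.sym G v u) uv

  across : ∀ {u v} → adj G u v ≡ true → u ∈ X → v ∉ X
  across {u} {v} uv u∈X with bip u v uv
  ... | inj₁ (_ , v∉X) = v∉X
  ... | inj₂ (u∉X , _) = contradiction u∈X u∉X

  across′ : ∀ {u v} → adj G u v ≡ true → u ∉ X → v ∈ X
  across′ {u} {v} uv u∉X with bip u v uv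
  ... | inj₁ (u∈X , _) = contradiction u∈X u∉X
  ... | inj₂ (_ , v∈X) = v∈X

  X-independent : ∀ {u v} → u ∈ X → v ∈ X → adj G u v ≡ false
  X-independent {u} {v} u∈X v∈X with adj G u v in uv
  ... | true  = contradiction v∈X (across uv u∈X)
  ... | false = refl

  ∉X⇒∉S : ∀ {u} → u ∉ X → u ∉ S
  ∉X⇒∉S u∉X u∈S = u∉X (S⊆X u∈S)

  no-better : (H : Graph n) → IsBipartition H X → ConnProp H k → IsVertexCut H S →
              M1 G < M1 H → ⊥
  no-better H bipH connH cutH G<H =
    <⇒≱ G<H (M1-max H ((X , bipH) , cut⇒connectivity H S connH cutH ∣S∣≡k))

  -- G together with the edge xy (for x ∈ X and y ∉ X).
  withEdge? : ∀ x y u v → Dec (adj G u v ≡ true ⊎ (u ≡ x × v ≡ y))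
  withEdge? x y u v = (adj G u v ≟ᵇ true) ⊎-dec ((u ≟ x) ×-dec (v ≟ y))

  G+ : Fin n → Fin n → Graph n
  G+ x y = crossGraph X (withEdge? x y)

  G⊑G+ : ∀ x y → G ⊑ G+ x y
  G⊑G+ x y u v uv with bip u v uv
  ... | inj₁ (u∈X , v∉X) = crossGraph-edge⁺ X (withEdge? x y) (u∈X , v∉X , inj₁ uv)
  ... | inj₂ (u∉X , v∈X) =
    trans (Graph.sym (G+ x y) u v)
          (crossGraph-edge⁺ X (withEdge? x y) (v∈X , u∉X , inj₁ (adj-sym uv)))

  G+-walk : ∀ x y {T} → (x ∉ T → y ∉ T → Reach G T x y) →
            ∀ {a b} → Reach (G+ x y) T a b → Reach G T a b
  G+-walk x y x⇝y (here a∉T) = here a∉T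
  G+-walk x y x⇝y (step a∉T e rest) with crossGraph-edge⁻ X (withEdge? x y) e
  ... | inj₁ (_ , _ , inj₁ uv)           = step a∉T uv (G+-walk x y x⇝y rest)
  ... | inj₁ (_ , _ , inj₂ (refl , refl)) =
    reach-trans (x⇝y a∉T (reach-start rest)) (G+-walk x y x⇝y rest)
  ... | inj₂ (_ , _ , inj₁ vu)           = step a∉T (adj-sym vu) (G+-walk x y x⇝y rest)
  ... | inj₂ (_ , _ , inj₂ (refl , refl)) =
    reach-trans (reach-sym (x⇝y (reach-start rest) a∉T)) (G+-walk x y x⇝y rest)

  -- Saturation: if adding xy would keep S a cut, then xy is already an edge,
  -- since otherwise G + xy would be a competitor with larger M1.
  saturated : ∀ {x y} → x ∈ X → y ∉ X → IsVertexCut (G+ x y) S → adj G x y ≡ true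
  saturated {x} {y} x∈X y∉X cut with adj G x y in xy
  ... | true  = refl
  ... | false = ⊥-elim (no-better (G+ x y) bipartite connected cut larger)
    where
    bipartite : IsBipartition (G+ x y) X
    bipartite = crossGraph-bipartite X (withEdge? x y)
    connected : ConnProp (G+ x y) k
    connected = ConnProp-⊑ (G⊑G+ x y) connG
    larger : M1 G < M1 (G+ x y)
    larger = M1-supergraph G (G+ x y) (G⊑G+ x y) x y xy
               (crossGraph-edge⁺ X (withEdge? x y) (x∈X , y∉X , inj₂ (refl , refl)))

  reach⇒adjacent : ∀ {x y} → x ∈ X → y ∉ X → Reach G S x y → adj G x y ≡ true
  reach⇒adjacent {x} {y} x∈X y∉X x⇝y = saturated x∈X y∉X λ connected →
    S-cut λ a b a∉S b∉S → G+-walk x y (λ _ _ → x⇝y) (connected a b a∉S b∉S)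

  Linked : Fin n → Fin n → Set
  Linked x₁ x₂ = x₁ ≡ x₂ ⊎ ∃ λ y → adj G x₁ y ≡ true × adj G x₂ y ≡ true

  linked? : ∀ x₁ x₂ → Dec (Linked x₁ x₂)
  linked? x₁ x₂ = (x₁ ≟ x₂) ⊎-dec any? (λ y → (adj G x₁ y ≟ᵇ true) ×-dec (adj G x₂ y ≟ᵇ true))

  reach⇒linked : ∀ {x₁ x₂} → x₁ ∈ X → x₂ ∈ X → Reach G S x₁ x₂ → Linked x₁ x₂
  reach⇒linked x₁∈X x₂∈X (here _)             = inj₁ refl
  reach⇒linked x₁∈X x₂∈X (step {v = y} _ x₁y rest) =
    inj₂ (y , x₁y , reach⇒adjacent x₂∈X (across x₁y x₁∈X) (reach-sym rest))

  linked⇒reach : ∀ {x₁ x₂} → x₁ ∈ X → x₁ ∉ S → x₂ ∉ S → Linked x₁ x₂ → Reach G S x₁ x₂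
  linked⇒reach x₁∈X x₁∉S x₂∉S (inj₁ refl) = here x₁∉S
  linked⇒reach x₁∈X x₁∉S x₂∉S (inj₂ (y , x₁y , x₂y)) =
    step x₁∉S x₁y (reach-edge (∉X⇒∉S (across x₁y x₁∈X)) x₂∉S (adj-sym x₂y))

  -- Two vertices x₁, x₂ of X ∖ S that are not linked lie in different
  -- components of G - S.  Then the graph H joining every vertex of X to every
  -- vertex outside X, except X ∖ S to y₀ (a neighbour of x₁), is a competitor
  -- with larger M1; so this situation is impossible.
  module Separated {x₁ x₂ : Fin n} (x₁∈X : x₁ ∈ X) (x₁∉S : x₁ ∉ S)
                   (x₂∈X : x₂ ∈ X) (x₂∉S : x₂ ∉ S) (unlinked : ¬ Linked x₁ x₂) where

    x₁≢x₂ : x₁ ≢ x₂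
    x₁≢x₂ = unlinked ∘ inj₁

    y₀ : Fin n
    y₀ = proj₁ (has-neighbour G connG 0<k x₁≢x₂)

    x₁y₀ : adj G x₁ y₀ ≡ true
    x₁y₀ = proj₂ (has-neighbour G connG 0<k x₁≢x₂)

    y₂ : Fin n
    y₂ = proj₁ (has-neighbour G connG 0<k (x₁≢x₂ ∘ sym))

    x₂y₂ : adj G x₂ y₂ ≡ true
    x₂y₂ = proj₂ (has-neighbour G connG 0<k (x₁≢x₂ ∘ sym))

    y₀∉X : y₀ ∉ X
    y₀∉X = across x₁y₀ x₁∈X

    y₂∉X : y₂ ∉ X
    y₂∉X = across x₂y₂ x₂∈X

    y₀x₂∉G : adj G y₀ x₂ ≡ false
    y₀x₂∉G with adj G y₀ x₂ in y₀x₂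
    ... | true  = ⊥-elim (unlinked (inj₂ (y₀ , x₁y₀ , adj-sym y₀x₂)))
    ... | false = refl

    y₂≢y₀ : y₂ ≢ y₀
    y₂≢y₀ y₂≡y₀ = unlinked (inj₂ (y₀ , x₁y₀ , subst (λ z → adj G x₂ z ≡ true) y₂≡y₀ x₂y₂))

    -- y₀ and y₂ have no common neighbour outside S: it would link x₁ to x₂.
    no-bridge : ∀ {v} → v ∉ S → adj G y₀ v ≡ true → adj G y₂ v ≡ true → ⊥
    no-bridge {v} v∉S y₀v y₂v = unlinked (reach⇒linked x₁∈X x₂∈X
      (step x₁∉S x₁y₀ (step y₀∉S y₀v (step v∉S (adj-sym y₂v)
        (reach-edge y₂∉S x₂∉S (adj-sym x₂y₂))))))
      where
      y₀∉S : y₀ ∉ S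
      y₀∉S = ∉X⇒∉S y₀∉X
      y₂∉S : y₂ ∉ S
      y₂∉S = ∉X⇒∉S y₂∉X

    allowed? : ∀ u v → Dec (u ∈ S ⊎ v ≢ y₀)
    allowed? u v = (u ∈? S) ⊎-dec ¬? (v ≟ y₀)

    H : Graph n
    H = crossGraph X allowed?

    H-edge : ∀ {u v} → u ∈ X → v ∉ X → u ∈ S ⊎ v ≢ y₀ → adj H u v ≡ true
    H-edge u∈X v∉X ok = crossGraph-edge⁺ X allowed? (u∈X , v∉X , ok)

    H-edge′ : ∀ {u v} → u ∈ X → v ∉ X → u ∈ S ⊎ v ≢ y₀ → adj H v u ≡ true
    H-edge′ {u} {v} u∈X v∉X ok = trans (Graph.sym H v u) (H-edge u∈X v∉X ok)

    -- x₂ has at least k neighbours, since it is not adjacent to x₁.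
    k≤∣N₂∣ : k ≤ ∣ nbhd G x₂ ∣
    k≤∣N₂∣ = subst (k ≤_) (degree≡∣nbhd∣ G x₂)
                   (min-degree G connG (x₁≢x₂ ∘ sym) (X-independent x₂∈X x₁∈X))

    -- H - T is connected for |T| < k: some s ∈ S and some neighbour y ≠ y₀ of
    -- x₂ survive, and every vertex is joined to s directly or through y.
    H-reach : ∀ T → ∣ T ∣ < k → Connected- H T
    H-reach T ∣T∣<k u v u∉T v∉T
      with larger⇒element-outside S T (subst (∣ T ∣ <_) (sym ∣S∣≡k) ∣T∣<k)
         | larger⇒element-outside (nbhd G x₂) T (<-≤-trans ∣T∣<k k≤∣N₂∣)
    ... | s , s∈S , s∉T | y , y∈N₂ , y∉T = reach-trans (to-s u∉T) (reach-sym (to-s v∉T))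
      where
      x₂y : adj G x₂ y ≡ true
      x₂y = ∈nbhd⁻ G y∈N₂
      y∉X : y ∉ X
      y∉X = across x₂y x₂∈X
      y≢y₀ : y ≢ y₀
      y≢y₀ refl = contradiction (trans (sym x₂y) (trans (Graph.sym G x₂ y₀) y₀x₂∉G)) λ ()
      to-s : ∀ {u} → u ∉ T → Reach H T u s
      to-s {u} u∉T with u ∈? X
      ... | yes u∈X = step u∉T (H-edge u∈X y∉X (inj₂ y≢y₀))
                        (reach-edge y∉T s∉T (H-edge′ (S⊆X s∈S) y∉X (inj₁ s∈S)))
      ... | no u∉X  = reach-edge u∉T s∉T (H-edge′ (S⊆X s∈S) u∉X (inj₁ s∈S))

    -- S is still a cut of H: all H-neighbours of y₀ lie in S.
    H-cut : IsVertexCut H S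
    H-cut connected = y₀∉X (subst (_∈ X) (sym y₀≡x₁) x₁∈X)
      where
      y₀-trapped : ∀ v → adj H y₀ v ≡ true → v ∈ S
      y₀-trapped v e with crossGraph-edge⁻ X allowed? e
      ... | inj₁ (y₀∈X , _ , _)        = contradiction y₀∈X y₀∉X
      ... | inj₂ (_ , _ , inj₁ v∈S)    = v∈S
      ... | inj₂ (_ , _ , inj₂ y₀≢y₀)  = contradiction refl y₀≢y₀
      y₀≡x₁ : y₀ ≡ x₁
      y₀≡x₁ = trapped y₀-trapped (connected y₀ x₁ (∉X⇒∉S y₀∉X) x₁∉S)

    A : Subset n
    A = nbhd G y₀ ∩ ∁ S

    ∈A⁺ : ∀ {v} → adj G y₀ v ≡ true → v ∉ S → v ∈ A
    ∈A⁺ y₀v v∉S = x∈p∩q⁺ (∈nbhd⁺ G y₀v , x∉p⇒x∈∁p v∉S)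

    ∈A⁻ : ∀ {v} → v ∈ A → adj G y₀ v ≡ true × v ∉ S
    ∈A⁻ v∈A with x∈p∩q⁻ (nbhd G y₀) (∁ S) v∈A
    ... | v∈N , v∈∁S = ∈nbhd⁻ G v∈N , x∈∁p⇒x∉p v∈∁S

    degree-y₀ : degree G y₀ ≤ k + ∣ A ∣
    degree-y₀ = begin
      degree G y₀     ≡⟨ degree≡∣nbhd∣ G y₀ ⟩
      ∣ nbhd G y₀ ∣   ≤⟨ p⊆q⇒∣p∣≤∣q∣ N₀⊆S∪A ⟩
      ∣ S ∪ A ∣       ≤⟨ ∣p∪q∣≤∣p∣+∣q∣ S A ⟩
      ∣ S ∣ + ∣ A ∣   ≡⟨ cong (_+ ∣ A ∣) ∣S∣≡k ⟩
      k + ∣ A ∣       ∎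
      where
      open ≤-Reasoning
      N₀⊆S∪A : nbhd G y₀ ⊆ S ∪ A
      N₀⊆S∪A {v} v∈N with v ∈? S
      ... | yes v∈S = x∈p∪q⁺ (inj₁ v∈S)
      ... | no v∉S  = x∈p∪q⁺ (inj₂ (∈A⁺ (∈nbhd⁻ G v∈N) v∉S))

    -- d_G(y₂) + |A| ≤ |X|, as the neighbours of y₂ and A are disjoint parts of X.
    degree-y₂ : degree G y₂ + ∣ A ∣ ≤ ∣ X ∣
    degree-y₂ = begin
      degree G y₂ + ∣ A ∣     ≡⟨ cong (_+ ∣ A ∣) (degree≡∣nbhd∣ G y₂) ⟩
      ∣ nbhd G y₂ ∣ + ∣ A ∣   ≡⟨ disjoint-∣p∪q∣ (nbhd G y₂) A disjoint ⟨
      ∣ nbhd G y₂ ∪ A ∣       ≤⟨ p⊆q⇒∣p∣≤∣q∣ N₂∪A⊆X ⟩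
      ∣ X ∣                   ∎
      where
      open ≤-Reasoning
      disjoint : Empty (nbhd G y₂ ∩ A)
      disjoint (v , v∈N₂∩A) with x∈p∩q⁻ (nbhd G y₂) A v∈N₂∩A
      ... | v∈N₂ , v∈A = no-bridge (proj₂ (∈A⁻ v∈A)) (proj₁ (∈A⁻ v∈A)) (∈nbhd⁻ G v∈N₂)
      N₂∪A⊆X : nbhd G y₂ ∪ A ⊆ X
      N₂∪A⊆X {v} v∈N₂∪A with x∈p∪q⁻ (nbhd G y₂) A v∈N₂∪A
      ... | inj₁ v∈N₂ = across′ (∈nbhd⁻ G v∈N₂) y₂∉X
      ... | inj₂ v∈A  = across′ (proj₁ (∈A⁻ v∈A)) y₀∉X

    -- k + |A| < |X|: S and A are disjoint parts of X missing x₂.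
    k+∣A∣<∣X∣ : k + ∣ A ∣ < ∣ X ∣
    k+∣A∣<∣X∣ = begin-strict
      k + ∣ A ∣       ≡⟨ cong (_+ ∣ A ∣) ∣S∣≡k ⟨
      ∣ S ∣ + ∣ A ∣   ≡⟨ disjoint-∣p∪q∣ S A disjoint ⟨
      ∣ S ∪ A ∣       <⟨ p⊂q⇒∣p∣<∣q∣ (S∪A⊆X , x₂ , x₂∈X , x₂∉S∪A) ⟩
      ∣ X ∣           ∎
      where
      open ≤-Reasoning
      disjoint : Empty (S ∩ A)
      disjoint (v , v∈S∩A) with x∈p∩q⁻ S A v∈S∩A
      ... | v∈S , v∈A = proj₂ (∈A⁻ v∈A) v∈S
      S∪A⊆X : S ∪ A ⊆ X
      S∪A⊆X {v} v∈S∪A with x∈p∪q⁻ S A v∈S∪A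
      ... | inj₁ v∈S = S⊆X v∈S
      ... | inj₂ v∈A = across′ (proj₁ (∈A⁻ v∈A)) y₀∉X
      x₂∉S∪A : x₂ ∉ S ∪ A
      x₂∉S∪A x₂∈S∪A with x∈p∪q⁻ S A x₂∈S∪A
      ... | inj₁ x₂∈S = x₂∉S x₂∈S
      ... | inj₂ x₂∈A = contradiction (trans (sym (proj₁ (∈A⁻ x₂∈A))) y₀x₂∉G) λ ()

    0<∣A∣ : 0 < ∣ A ∣
    0<∣A∣ = subst (_< ∣ A ∣) (∣⊥∣≡0 n) (p⊂q⇒∣p∣<∣q∣ (⊥⊆ , x₁ , ∈A⁺ (adj-sym x₁y₀) x₁∉S , ∉⊥))

    -- In H, y₀ is joined to all of S and y₂ to all of X.
    k≤degree-H-y₀ : k ≤ degree H y₀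
    k≤degree-H-y₀ = subst₂ _≤_ ∣S∣≡k (sym (degree≡∣nbhd∣ H y₀))
      (p⊆q⇒∣p∣≤∣q∣ λ s∈S → ∈nbhd⁺ H {y₀} (H-edge′ (S⊆X s∈S) y₀∉X (inj₁ s∈S)))

    ∣X∣≤degree-H-y₂ : ∣ X ∣ ≤ degree H y₂
    ∣X∣≤degree-H-y₂ = subst (∣ X ∣ ≤_) (sym (degree≡∣nbhd∣ H y₂))
      (p⊆q⇒∣p∣≤∣q∣ λ x∈X → ∈nbhd⁺ H {y₂} (H-edge′ x∈X y₂∉X (inj₂ y₂≢y₀)))

    -- A vertex v of X ∖ S misses y₀ or y₂ in G (no-bridge); in H it misses
    -- only y₀.  Either way d_G(v) ≤ d_H(v).
    X∖S-bound : ∀ {v} → v ∈ X → v ∉ S → ∣ nbhd G v ∣ ≤ ∣ nbhd H v ∣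
    X∖S-bound {v} v∈X v∉S with adj G v y₀ in vy₀
    ... | false = p⊆q⇒∣p∣≤∣q∣ λ {w} w∈N → ∈nbhd⁺ H {v}
          (H-edge v∈X (across (∈nbhd⁻ G w∈N) v∈X) (inj₂ λ w≡y₀ →
            contradiction (trans (sym vy₀) (subst (λ z → adj G v z ≡ true) w≡y₀ (∈nbhd⁻ G w∈N)))
                          λ ()))
    ... | true  = ⊂-one-more⇒≤ y₀ (N⊆∁X , y₂ , x∉p⇒x∈∁p y₂∉X , y₂∉N) ∁X⊆N′∪y₀
      where
      N⊆∁X : nbhd G v ⊆ ∁ X
      N⊆∁X w∈N = x∉p⇒x∈∁p (across (∈nbhd⁻ G w∈N) v∈X)
      y₂∉N : y₂ ∉ nbhd G v
      y₂∉N y₂∈N = no-bridge v∉S (adj-sym vy₀) (adj-sym (∈nbhd⁻ G y₂∈N))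
      ∁X⊆N′∪y₀ : ∁ X ⊆ nbhd H v ∪ ⁅ y₀ ⁆
      ∁X⊆N′∪y₀ {w} w∈∁X with w ≟ y₀
      ... | yes refl  = x∈p∪q⁺ (inj₂ (x∈⁅x⁆ y₀))
      ... | no w≢y₀   = x∈p∪q⁺ (inj₁ (∈nbhd⁺ H {v} (H-edge v∈X (x∈∁p⇒x∉p w∈∁X) (inj₂ w≢y₀))))

    degree-kept : ∀ v → v ≢ y₀ → v ≢ y₂ → degree G v ≤ degree H v
    degree-kept v v≢y₀ _ = subst₂ _≤_ (sym (degree≡∣nbhd∣ G v)) (sym (degree≡∣nbhd∣ H v))
                                  (nbhd-bound (v ∈? X) (v ∈? S))
      where
      nbhd-bound : Dec (v ∈ X) → Dec (v ∈ S) → ∣ nbhd G v ∣ ≤ ∣ nbhd H v ∣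
      nbhd-bound (no v∉X)  _         = p⊆q⇒∣p∣≤∣q∣ λ w∈N →
        ∈nbhd⁺ H {v} (H-edge′ (across′ (∈nbhd⁻ G w∈N) v∉X) v∉X (inj₂ v≢y₀))
      nbhd-bound (yes v∈X) (yes v∈S) = p⊆q⇒∣p∣≤∣q∣ λ w∈N →
        ∈nbhd⁺ H {v} (H-edge v∈X (across (∈nbhd⁻ G w∈N) v∈X) (inj₁ v∈S))
      nbhd-bound (yes v∈X) (no v∉S)  = X∖S-bound v∈X v∉S

    H-better : M1 G < M1 H
    H-better = M1-increase G H y₀ y₂ (y₂≢y₀ ∘ sym) degree-kept
      (squares-bound degree-y₀ degree-y₂ k+∣A∣<∣X∣ 0<∣A∣ k≤degree-H-y₀ ∣X∣≤degree-H-y₂)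

    impossible : ⊥
    impossible =
      no-better H (crossGraph-bipartite X allowed?) (proj₁ connG , H-reach) H-cut H-better

  X∖S-linked : ∀ {x₁ x₂} → x₁ ∈ X → x₁ ∉ S → x₂ ∈ X → x₂ ∉ S → Linked x₁ x₂
  X∖S-linked {x₁} {x₂} x₁∈X x₁∉S x₂∈X x₂∉S =
    decidable-stable (linked? x₁ x₂) (Separated.impossible x₁∈X x₁∉S x₂∈X x₂∉S)

  module Components (linked : ∀ {x₁ x₂} → x₁ ∈ X → x₁ ∉ S → x₂ ∈ X → x₂ ∉ S → Linked x₁ x₂)
                    (k<∣X∣ : k < ∣ X ∣) where

    x₀-exists : ∃ λ x → x ∈ X × x ∉ S
    x₀-exists = larger⇒element-outside X S (subst (_< ∣ X ∣) (sym ∣S∣≡k) k<∣X∣)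

    x₀ : Fin n
    x₀ = proj₁ x₀-exists

    x₀∈X : x₀ ∈ X
    x₀∈X = proj₁ (proj₂ x₀-exists)

    x₀∉S : x₀ ∉ S
    x₀∉S = proj₂ (proj₂ x₀-exists)

    X∖S-reach : ∀ {x} → x ∈ X → x ∉ S → Reach G S x x₀
    X∖S-reach x∈X x∉S = linked⇒reach x∈X x∉S x₀∉S (linked x∈X x∉S x₀∈X x₀∉S)

    X∖S-neighbour? : ∀ w x → Dec ((x ∈ X × x ∉ S) × adj G x w ≡ true)
    X∖S-neighbour? w x = ((x ∈? X) ×-dec ¬? (x ∈? S)) ×-dec (adj G x w ≟ᵇ true)

    Lonely : Fin n → Set
    Lonely w = w ∉ X × ¬ (∃ λ x → (x ∈ X × x ∉ S) × adj G x w ≡ true)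

    -- Without a lonely vertex every vertex of G - S reaches x₀, contradicting
    -- that S is a cut.
    lonely-exists : ∃ Lonely
    lonely-exists with any? (λ w → ¬? (w ∈? X) ×-dec ¬? (any? (X∖S-neighbour? w)))
    ... | yes lonely = lonely
    ... | no none    =
      ⊥-elim (S-cut λ u v u∉S v∉S → reach-trans (to-x₀ u∉S) (reach-sym (to-x₀ v∉S)))
      where
      to-x₀ : ∀ {u} → u ∉ S → Reach G S u x₀
      to-x₀ {u} u∉S with u ∈? X | any? (X∖S-neighbour? u)
      ... | yes u∈X | _                              = X∖S-reach u∈X u∉S
      ... | no u∉X  | yes (x , (x∈X , x∉S) , xu)     = step u∉S (adj-sym xu) (X∖S-reach x∈X x∉S)
      ... | no u∉X  | no no-neighbour                = ⊥-elim (none (u , u∉X , no-neighbour))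

    w : Fin n
    w = proj₁ lonely-exists

    w∉X : w ∉ X
    w∉X = proj₁ (proj₂ lonely-exists)

    w∉S : w ∉ S
    w∉S = ∉X⇒∉S w∉X

    x₀≢w : x₀ ≢ w
    x₀≢w x₀≡w = w∉X (subst (_∈ X) x₀≡w x₀∈X)

    -- w is isolated in G - S: its neighbours lie in X, hence in S.
    w-isolated : ∀ u → u ∉ S → adj G w u ≡ false
    w-isolated u u∉S with adj G w u in wu
    ... | true  = ⊥-elim (proj₂ (proj₂ lonely-exists) (u , (across′ wu w∉X , u∉S) , adj-sym wu))
    ... | false = refl

    -- Every vertex of X ∖ S is adjacent to every vertex outside X except w:
    -- adding such an edge leaves w isolated in G - S, so S stays a cut.
    joined : ∀ {x y} → x ∈ X → x ∉ S → y ∉ X → y ≢ w → adj G x y ≡ true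
    joined {x} {y} x∈X x∉S y∉X y≢w = saturated x∈X y∉X λ connected →
      x₀≢w (sym (trapped w-trapped (connected w x₀ w∉S x₀∉S)))
      where
      w-trapped : ∀ v → adj (G+ x y) w v ≡ true → v ∈ S
      w-trapped v e with crossGraph-edge⁻ X (withEdge? x y) e
      ... | inj₁ (w∈X , _)                 = contradiction w∈X w∉X
      ... | inj₂ (_ , _ , inj₂ (_ , w≡y))  = contradiction (sym w≡y) y≢w
      ... | inj₂ (v∈X , _ , inj₁ vw) with v ∈? S
      ...   | yes v∈S = v∈S
      ...   | no v∉S  = contradiction (trans (sym (adj-sym vw)) (w-isolated v v∉S)) λ ()

    y₀ : Fin n
    y₀ = proj₁ (has-neighbour G connG 0<k x₀≢w)

    x₀y₀ : adj G x₀ y₀ ≡ true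
    x₀y₀ = proj₂ (has-neighbour G connG 0<k x₀≢w)

    y₀∉X : y₀ ∉ X
    y₀∉X = across x₀y₀ x₀∈X

    y₀≢w : y₀ ≢ w
    y₀≢w y₀≡w = proj₂ (proj₂ lonely-exists)
                  (x₀ , (x₀∈X , x₀∉S) , subst (λ z → adj G x₀ z ≡ true) y₀≡w x₀y₀)

    to-x₀ : ∀ {u} → u ∉ S → u ≢ w → Reach G S u x₀
    to-x₀ {u} u∉S u≢w with u ∈? X
    ... | yes u∈X = step u∉S (joined u∈X u∉S y₀∉X y₀≢w)
                      (reach-edge (∉X⇒∉S y₀∉X) x₀∉S (adj-sym x₀y₀))
    ... | no u∉X  = reach-edge u∉S x₀∉S (adj-sym (joined x₀∈X x₀∉S u∉X u≢w))

    two-components : TwoComponentsOneTrivial G S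
    two-components = w , w∉S , w-isolated , (x₀ , x₀∉S , x₀≢w) ,
      λ u v u∉S v∉S u≢w v≢w → reach-trans (to-x₀ u∉S u≢w) (reach-sym (to-x₀ v∉S v≢w))

-- Lemma 2.4.
lemma2p4 : (n k : ℕ) → 0 < n → 0 < k → (G : Graph n) → InClass n k G
    → (∀ (H : Graph n) → InClass n k H → M1 H ≤ M1 G)
    → (∀ (H : Graph n) → InClass n k H → M2 H ≤ M2 G)
    → (X : Subset n) → IsBipartition G X
    → (S : Subset n) → IsVertexCut G S → ∣ S ∣ ≡ k → S ⊆ X → k < ∣ X ∣
    → TwoComponentsOneTrivial G S
lemma2p4 n k _ 0<k G (_ , κG) M1-max _ X bip S S-cut ∣S∣≡k S⊆X k<∣X∣ =
  Components.two-components X∖S-linked k<∣X∣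
  where open Extremal G κG 0<k M1-max X bip S S-cut ∣S∣≡k S⊆X
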